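{- Let $\mathbf{p}=p_{n-1}\dots p_0$ be an $(m,n)$-parking function and $\Delta$ a bounded, co-bounded $m$-invariant set with $\mathbf{p}\cdot\Delta=\Delta+n$, and put $\Delta^{(i)}=p_{i-1}\cdots p_0\cdot\Delta$ for $0\le i\le n$. Then $\bigcup_{i=0}^{n}\mathrm{mgen}(\Delta^{(i)})$ equals the union of the set of $m$-generators of $\Delta+n$ and the set of $n$-cogenerators of $\Delta+n$.
   Context: $[m]=\{0,\dots,m-1\}$. $\Delta\subset\mathbb{Z}$ is $k$-invariant if $\Delta+k\subset\Delta$; bounded = has a minimum, co-bounded = contains $\mathbb{Z}_{\ge K}$ for some $K$. An element $a\in\Delta$ is a $k$-generator if $a-k\notin\Delta$; $a\notin\Delta$ is a $k$-cogenerator if $a+k\in\Delta$. $\mathrm{mgen}(\Delta)$ denotes the set of $m$-generators $\{a_0<\dots<a_{m-1}\}$ of $\Delta$. A letter $j\in[m]$ acts by $j\cdot\Delta=\Delta\setminus\{a_j\}$; words act from right to left (letter $p_0$ first). An $(m,n)$-parking function is $\mathbf{p}=p_{n-1}\dots p_0\in[m]^n$ with $\#\{j:p_j<i\}\ge in/m$ for $1\le i\le m$. -}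

module Defs where

open import Level using (0ℓ)
open import Data.Nat as ℕ using (ℕ; zero; suc)
open import Data.Fin as Fin using (Fin; toℕ)
open import Data.Integer using (ℤ; +_; _+_; _-_; _≤_; _<_)
open import Data.List using (List; length; filter)
open import Data.List.Base using (allFin)
open import Data.Product using (Σ; ∃; ∃-syntax; _×_; _,_)
open import Relation.Unary using (Pred; _∈_; _∉_)
open import Relation.Binary.PropositionalEquality using (_≡_; _≢_)
open import Function.Bundles using (_⇔_)

SubsetZ : Set₁
SubsetZ = Pred ℤ 0ℓ

Invariant : ℕ → SubsetZ → Set
Invariant k Δ = ∀ x → x ∈ Δ → (x + + k) ∈ Δ

-- bounded: has a lower bound (equivalently a minimum, for a nonempty subset of ℤ)
Bounded : SubsetZ → Set
Bounded Δ = ∃[ b ] ∀ x → x ∈ Δ → b ≤ x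

CoBounded : SubsetZ → Set
CoBounded Δ = ∃[ K ] ∀ x → K ≤ x → x ∈ Δ

shift : SubsetZ → ℕ → SubsetZ
shift Δ k x = (x - + k) ∈ Δ

IsGen : ℕ → SubsetZ → ℤ → Set
IsGen k Δ a = a ∈ Δ × (a - + k) ∉ Δ

IsCogen : ℕ → SubsetZ → ℤ → Set
IsCogen k Δ a = a ∉ Δ × (a + + k) ∈ Δ

MGenEnum : (m : ℕ) → SubsetZ → (Fin m → ℤ) → Set
MGenEnum m Δ g =
  (∀ i j → i Fin.< j → g i < g j) ×
  (∀ a → IsGen m Δ a ⇔ (∃[ i ] g i ≡ a))

Acts : (m : ℕ) → Fin m → SubsetZ → SubsetZ → Set
Acts m j Δ Δ' =
  Σ (Fin m → ℤ) λ g → MGenEnum m Δ g ×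
    (∀ x → x ∈ Δ' ⇔ (x ∈ Δ × x ≢ g j))

countBelow : {m n : ℕ} → (Fin n → Fin m) → ℕ → ℕ
countBelow {n = n} p i = length (filter (λ j → toℕ (p j) ℕ.<? i) (allFin n))

-- (m,n)-parking function p = p_{n-1} … p_0, given as j ↦ p_j :
-- #{j : p_j < i} ≥ i n / m for 1 ≤ i ≤ m  (cleared of denominators)
IsParking : (m n : ℕ) → (Fin n → Fin m) → Set
IsParking m n p = ∀ i → 1 ℕ.≤ i → i ℕ.≤ m → i ℕ.* n ℕ.≤ m ℕ.* countBelow p i

-- Each letter deletes one m-generator, so D 0 ⊇ D 1 ⊇ … ⊇ D n and the elements
-- deleted along the way are D 0 ∖ D n = Δ ∖ (Δ + n), i.e. the n-cogenerators of
-- Δ + n. An m-generator of some D i either survives to D n, where it is still an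
-- m-generator because the sets only shrink, or it is deleted later; conversely an
-- element is only ever deleted while it is an m-generator.
{-# OPTIONS --safe #-}
module Submission where

open import Defs
open import Data.Nat using (ℕ; zero; suc; _≤_; _<_; z≤n; s≤s)
open import Data.Nat.Properties using (≤-refl; <⇒≤)
open import Data.Fin as Fin using (Fin; toℕ)
open import Data.Integer using (ℤ; +_; _+_; _-_; _≟_)
import Data.Integer.Properties as ℤ
open import Algebra.Properties.AbelianGroup ℤ.+-0-abelianGroup using (//-rightDividesʳ)
open import Data.Product using (∃-syntax; _×_; _,_; proj₁; proj₂)
open import Data.Sum using (_⊎_; inj₁; inj₂)
open import Data.Sum.Function.Propositional using (_⊎-⇔_)
open import Data.Empty using (⊥-elim)
open import Relation.Nullary using (yes; no)
open import Relation.Unary using (_≐_; _⊆_; _∈_; _∉_)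
open import Relation.Binary.PropositionalEquality using (_≢_; refl; sym; subst)
open import Function.Bundles using (_⇔_; mk⇔; Equivalence)
open import Function using (_∘′_)
import Function.Properties.Equivalence as ⇔

open Equivalence

IsGen-⊆ : ∀ {k} {Δ Δ′ : SubsetZ} {a} → Δ′ ⊆ Δ → IsGen k Δ a → a ∈ Δ′ → IsGen k Δ′ a
IsGen-⊆ {k} {a = a} Δ′⊆Δ (_ , a-k∉Δ) a∈Δ′ = a∈Δ′ , λ a-k∈Δ′ → a-k∉Δ (Δ′⊆Δ {a - + k} a-k∈Δ′)

IsGen-≐ : ∀ {k} {Δ Δ′ : SubsetZ} {a} → Δ ≐ Δ′ → IsGen k Δ a ⇔ IsGen k Δ′ a
IsGen-≐ {k} {Δ} {Δ′} {a} (Δ⊆Δ′ , Δ′⊆Δ) =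
  mk⇔ (λ g → IsGen-⊆ {k} {Δ} {Δ′} Δ′⊆Δ g (Δ⊆Δ′ {a} (proj₁ g)))
      (λ g → IsGen-⊆ {k} {Δ′} {Δ} Δ⊆Δ′ g (Δ′⊆Δ {a} (proj₁ g)))

+-∈-shift : ∀ {Δ : SubsetZ} {k a} → (a + + k) ∈ shift Δ k ⇔ a ∈ Δ
+-∈-shift {Δ} {k} {a} =
  mk⇔ (subst (_∈ Δ) (//-rightDividesʳ (+ k) a))
      (subst (_∈ Δ) (sym (//-rightDividesʳ (+ k) a)))

DeletesGen : ℕ → SubsetZ → SubsetZ → Set
DeletesGen m Δ Δ′ = ∃[ c ] (IsGen m Δ c × (∀ x → x ∈ Δ′ ⇔ (x ∈ Δ × x ≢ c)))

Acts⇒DeletesGen : ∀ {m j Δ Δ′} → Acts m j Δ Δ′ → DeletesGen m Δ Δ′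
Acts⇒DeletesGen {j = j} (g , (_ , isGen⇔) , Δ′⇔) =
  g j , from (isGen⇔ (g j)) (j , refl) , Δ′⇔

DeletesGen-⊆ : ∀ {m Δ Δ′} → DeletesGen m Δ Δ′ → Δ′ ⊆ Δ
DeletesGen-⊆ (_ , _ , Δ′⇔) {x} x∈Δ′ = proj₁ (to (Δ′⇔ x) x∈Δ′)

record DeletionChain (m : ℕ) (D : ℕ → SubsetZ) (n : ℕ) : Set where
  constructor deletionChain
  field deletes : ∀ (i : Fin n) → DeletesGen m (D (toℕ i)) (D (suc (toℕ i)))

open DeletionChain

module _ {m : ℕ} where

  chain-tail : ∀ {D n} → DeletionChain m D (suc n) → DeletionChain m (λ i → D (suc i)) n
  chain-tail chain = deletionChain λ i → deletes chain (Fin.suc i)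

  chain-⊆-head : ∀ {D n j} → DeletionChain m D n → j ≤ n → D j ⊆ D 0
  chain-⊆-head chain z≤n = λ x∈D₀ → x∈D₀
  chain-⊆-head {j = suc j} chain (s≤s j≤n) =
    DeletesGen-⊆ (deletes chain Fin.zero) ∘′ chain-⊆-head (chain-tail chain) j≤n

  chain-antitone : ∀ {D n i j} → DeletionChain m D n → i ≤ j → j ≤ n → D j ⊆ D i
  chain-antitone chain z≤n       j≤n       = chain-⊆-head chain j≤n
  chain-antitone chain (s≤s i≤j) (s≤s j≤n) = chain-antitone (chain-tail chain) i≤j j≤n

  survives-or-deleted : ∀ {D n a} → DeletionChain m D n → a ∈ D 0 →
    a ∈ D n ⊎ ∃[ i ] (i < n × IsGen m (D i) a × a ∉ D (suc i))
  survives-or-deleted {n = zero}  chain a∈D₀ = inj₁ a∈D₀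
  survives-or-deleted {n = suc n} {a} chain a∈D₀ with deletes chain Fin.zero
  ... | c , c-gen , D₁⇔ with a ≟ c
  ...   | yes refl = inj₂ (0 , s≤s z≤n , c-gen , λ c∈D₁ → proj₂ (to (D₁⇔ c) c∈D₁) refl)
  ...   | no a≢c with survives-or-deleted (chain-tail chain) (from (D₁⇔ a) (a∈D₀ , a≢c))
  ...     | inj₁ a∈Dₙ                  = inj₁ a∈Dₙ
  ...     | inj₂ (i , i<n , gen , a∉D) = inj₂ (suc i , s≤s i<n , gen , a∉D)

  chain-generators : ∀ {D n a} → DeletionChain m D n →
    (∃[ i ] (i ≤ n × IsGen m (D i) a)) ⇔ (IsGen m (D n) a ⊎ (a ∈ D 0 × a ∉ D n))
  chain-generators {D} {n} {a} chain = mk⇔ generator-fate deleted-or-last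
    where
    generator-fate : ∃[ i ] (i ≤ n × IsGen m (D i) a) → IsGen m (D n) a ⊎ (a ∈ D 0 × a ∉ D n)
    generator-fate (i , i≤n , gen@(a∈Dᵢ , _))
      with survives-or-deleted chain (chain-antitone chain z≤n i≤n a∈Dᵢ)
    ... | inj₁ a∈Dₙ = inj₁ (IsGen-⊆ {m} {D i} {D n} (chain-antitone chain i≤n ≤-refl) gen a∈Dₙ)
    ... | inj₂ (j , j<n , _ , a∉Dⱼ₊₁) =
          inj₂ ( chain-antitone chain z≤n i≤n a∈Dᵢ
               , λ a∈Dₙ → a∉Dⱼ₊₁ (chain-antitone chain j<n ≤-refl {a} a∈Dₙ))

    deleted-or-last : IsGen m (D n) a ⊎ (a ∈ D 0 × a ∉ D n) → ∃[ i ] (i ≤ n × IsGen m (D i) a)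
    deleted-or-last (inj₁ gen) = n , ≤-refl , gen
    deleted-or-last (inj₂ (a∈D₀ , a∉Dₙ)) with survives-or-deleted chain a∈D₀
    ... | inj₁ a∈Dₙ             = ⊥-elim (a∉Dₙ a∈Dₙ)
    ... | inj₂ (i , i<n , gen , _) = i , <⇒≤ i<n , gen

deleted⇔cogen : ∀ {Δ D₀ Dₙ : SubsetZ} {n a} → D₀ ≐ Δ → Dₙ ≐ shift Δ n →
  (a ∈ D₀ × a ∉ Dₙ) ⇔ IsCogen n (shift Δ n) a
deleted⇔cogen {Δ} {a = a} (D₀⊆Δ , Δ⊆D₀) (Dₙ⊆Δ+n , Δ+n⊆Dₙ) =
  mk⇔ (λ (a∈D₀ , a∉Dₙ) → a∉Dₙ ∘′ Δ+n⊆Dₙ {a} , from (+-∈-shift {Δ}) (D₀⊆Δ {a} a∈D₀))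
      (λ (a∉Δ+n , a+n∈Δ+n) → Δ⊆D₀ {a} (to (+-∈-shift {Δ}) a+n∈Δ+n) , a∉Δ+n ∘′ Dₙ⊆Δ+n {a})

mainTheorem8 : (m n : ℕ) (p : Fin n → Fin m) → IsParking m n p →
    (Δ : SubsetZ) → Bounded Δ → CoBounded Δ → Invariant m Δ →
    (D : ℕ → SubsetZ) → D zero ≐ Δ →
    (∀ (i : Fin n) → Acts m (p i) (D (toℕ i)) (D (suc (toℕ i)))) →
    D n ≐ shift Δ n →
    ∀ (a : ℤ) →
      (∃[ i ] (i ≤ n × IsGen m (D i) a))
        ⇔ (IsGen m (shift Δ n) a ⊎ IsCogen n (shift Δ n) a)
mainTheorem8 m n p _ Δ _ _ _ D D₀≐Δ acts Dₙ≐Δ+n a =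
  ⇔.trans (chain-generators {D = D} (deletionChain λ i → Acts⇒DeletesGen (acts i)))
          (IsGen-≐ {m} {D n} {shift Δ n} {a} Dₙ≐Δ+n ⊎-⇔ deleted⇔cogen D₀≐Δ Dₙ≐Δ+n)
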